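{- Let $x_1,x_2,x_3,d_1,d_2,d_3,L$ be integers, or let them be rational numbers, such that $x_1>0$, $x_2>0$, $x_3>0$, $d_1>0$, $d_2>0$, $d_3>0$, and suppose they satisfy the seven factor equations $$\tilde p_2=0,\quad \tilde p_3=0,\quad \tilde p_4=0,\quad \tilde p_5=0,\quad \tilde p_6=0,\quad \tilde p_7=0,\quad \tilde p_8=0.$$ Then they satisfy the Euler cuboid equations $p_1=0$, $p_2=0$, $p_3=0$.
   Context: Define the polynomials $p_0=x_1^2+x_2^2+x_3^2-L^2$, $p_1=x_2^2+x_3^2-d_1^2$, $p_2=x_3^2+x_1^2-d_2^2$, $p_3=x_1^2+x_2^2-d_3^2$, and $\tilde p_2=p_1+p_2+p_3$, $\tilde p_3=d_1p_1+d_2p_2+d_3p_3$, $\tilde p_4=x_1p_1+x_2p_2+x_3p_3$, $\tilde p_5=x_1d_1p_1+x_2d_2p_2+x_3d_3p_3$, $\tilde p_6=x_1^2p_1+x_2^2p_2+x_3^2p_3$, $\tilde p_7=d_1^2p_1+d_2^2p_2+d_3^2p_3$, $\tilde p_8=x_1^2d_1^2p_1+x_2^2d_2^2p_2+x_3^2d_3^2p_3$. -}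

module Defs where

open import Data.Integer as ℤ using (ℤ)
open import Data.Rational as ℚ using (ℚ)

module Polys {A : Set} (_⊕_ _⊗_ _⊖_ : A → A → A) where
  sq : A → A
  sq a = a ⊗ a

  p₀ : (x₁ x₂ x₃ L : A) → A
  p₀ x₁ x₂ x₃ L = ((sq x₁ ⊕ sq x₂) ⊕ sq x₃) ⊖ sq L

  p₁ : (x₁ x₂ x₃ d₁ : A) → A
  p₁ x₁ x₂ x₃ d₁ = (sq x₂ ⊕ sq x₃) ⊖ sq d₁

  p₂ : (x₁ x₂ x₃ d₂ : A) → A
  p₂ x₁ x₂ x₃ d₂ = (sq x₃ ⊕ sq x₁) ⊖ sq d₂

  p₃ : (x₁ x₂ x₃ d₃ : A) → A
  p₃ x₁ x₂ x₃ d₃ = (sq x₁ ⊕ sq x₂) ⊖ sq d₃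

  module _ (x₁ x₂ x₃ d₁ d₂ d₃ : A) where
    P₁ P₂ P₃ : A
    P₁ = p₁ x₁ x₂ x₃ d₁
    P₂ = p₂ x₁ x₂ x₃ d₂
    P₃ = p₃ x₁ x₂ x₃ d₃

    q₂ q₃ q₄ q₅ q₆ q₇ q₈ : A
    q₂ = (P₁ ⊕ P₂) ⊕ P₃
    q₃ = ((d₁ ⊗ P₁) ⊕ (d₂ ⊗ P₂)) ⊕ (d₃ ⊗ P₃)
    q₄ = ((x₁ ⊗ P₁) ⊕ (x₂ ⊗ P₂)) ⊕ (x₃ ⊗ P₃)
    q₅ = (((x₁ ⊗ d₁) ⊗ P₁) ⊕ ((x₂ ⊗ d₂) ⊗ P₂)) ⊕ ((x₃ ⊗ d₃) ⊗ P₃)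
    q₆ = ((sq x₁ ⊗ P₁) ⊕ (sq x₂ ⊗ P₂)) ⊕ (sq x₃ ⊗ P₃)
    q₇ = ((sq d₁ ⊗ P₁) ⊕ (sq d₂ ⊗ P₂)) ⊕ (sq d₃ ⊗ P₃)
    q₈ = (((sq x₁ ⊗ sq d₁) ⊗ P₁) ⊕ ((sq x₂ ⊗ sq d₂) ⊗ P₂)) ⊕ ((sq x₃ ⊗ sq d₃) ⊗ P₃)

-- integer instance; p̃ᵢ of the paper is qᵢ here (i = 2..8)
module ℤP = Polys ℤ._+_ ℤ._*_ ℤ._-_
module ℚP = Polys ℚ._+_ ℚ._*_ ℚ._-_

-- Write Pᵢ for the cuboid polynomial pᵢ and S = x₁² + x₂² + x₃².  Since
-- Pᵢ + xᵢ² + dᵢ² = S for each i, we have Pᵢ² + xᵢ² Pᵢ + dᵢ² Pᵢ = S Pᵢ, and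
-- summing over i gives the identity, valid in every commutative ring,
--
--     P₁² + P₂² + P₃² + p̃₆ + p̃₇ = S · p̃₂ .
--
-- Hence p̃₂ = p̃₆ = p̃₇ = 0 forces P₁² + P₂² + P₃² = 0, and in an ordered ring
-- a vanishing sum of three squares has vanishing terms, so P₁ = P₂ = P₃ = 0.
-- Only three of the seven factor equations are needed, and neither the
-- positivity hypotheses nor L play a role.

module Submission where

open import Defs
open import Data.Product using (_×_; _,_)
open import Relation.Binary.PropositionalEquality using (_≡_)
open import Data.Integer as ℤ using (ℤ)
open import Data.Rational as ℚ using (ℚ)

open import Algebra.Bundles using (CommutativeRing)
open import Data.Sum using (_⊎_; inj₁; inj₂)
open import Data.Empty using (⊥-elim)
open import Relation.Nullary using (¬_)
open import Level using (0ℓ)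
open import Relation.Binary.Definitions using (tri<; tri≈; tri>)
import Algebra.Properties.CommutativeSemigroup as CommutativeSemigroupProperties
import Algebra.Properties.Ring as RingProperties
import Relation.Binary.Reasoning.Setoid as SetoidReasoning
import Data.Integer.Properties as ℤₚ
import Data.Rational.Properties as ℚₚ

module CuboidIdentity {ℓ} (R : CommutativeRing 0ℓ ℓ) where
  open CommutativeRing R
  open CommutativeSemigroupProperties +-commutativeSemigroup using (interchange)
  open RingProperties ring using (//-rightDividesˡ)
  open SetoidReasoning setoid
  open Polys _+_ _*_ _-_

  +-triple-interchange : ∀ a₁ a₂ a₃ b₁ b₂ b₃ →
    (a₁ + a₂ + a₃) + (b₁ + b₂ + b₃) ≈ (a₁ + b₁) + (a₂ + b₂) + (a₃ + b₃)
  +-triple-interchange a₁ a₂ a₃ b₁ b₂ b₃ = begin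
    (a₁ + a₂ + a₃) + (b₁ + b₂ + b₃)      ≈⟨ interchange (a₁ + a₂) a₃ (b₁ + b₂) b₃ ⟩
    (a₁ + a₂ + (b₁ + b₂)) + (a₃ + b₃)    ≈⟨ +-congʳ (interchange a₁ a₂ b₁ b₂) ⟩
    (a₁ + b₁) + (a₂ + b₂) + (a₃ + b₃)    ∎

  +-rotate : ∀ a b c → a + b + c ≈ b + c + a
  +-rotate a b c = trans (+-assoc a b c) (+-comm a (b + c))

  sub-add-cancel : ∀ u t w → (u - w) + t + w ≈ u + t
  sub-add-cancel u t w = begin
    (u - w) + t + w      ≈⟨ +-assoc (u - w) t w ⟩
    (u - w) + (t + w)    ≈⟨ +-congˡ (+-comm t w) ⟩
    (u - w) + (w + t)    ≈⟨ +-assoc (u - w) w t ⟨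
    (u - w) + w + t      ≈⟨ +-congʳ (//-rightDividesˡ w u) ⟩
    u + t                ∎

  row-identity : ∀ u t w → let a = u - w in a * a + t * a + w * a ≈ (u + t) * a
  row-identity u t w = begin
    a * a + t * a + w * a    ≈⟨ +-congʳ (distribʳ a a t) ⟨
    (a + t) * a + w * a      ≈⟨ distribʳ a (a + t) w ⟨
    (a + t + w) * a          ≈⟨ *-congʳ (sub-add-cancel u t w) ⟩
    (u + t) * a              ∎
    where
    a : Carrier
    a = u - w

  module _ (x₁ x₂ x₃ d₁ d₂ d₃ : Carrier) where
    -- S = x₁² + x₂² + x₃², the common value of Pᵢ + xᵢ² + dᵢ².
    S : Carrier
    S = sq x₁ + sq x₂ + sq x₃

    private
      a₁ a₂ a₃ : Carrier
      a₁ = P₁ x₁ x₂ x₃ d₁ d₂ d₃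
      a₂ = P₂ x₁ x₂ x₃ d₁ d₂ d₃
      a₃ = P₃ x₁ x₂ x₃ d₁ d₂ d₃

    row₁ : a₁ * a₁ + sq x₁ * a₁ + sq d₁ * a₁ ≈ S * a₁
    row₁ = trans (row-identity (sq x₂ + sq x₃) (sq x₁) (sq d₁))
                 (*-congʳ (sym (+-rotate (sq x₁) (sq x₂) (sq x₃))))

    row₂ : a₂ * a₂ + sq x₂ * a₂ + sq d₂ * a₂ ≈ S * a₂
    row₂ = trans (row-identity (sq x₃ + sq x₁) (sq x₂) (sq d₂))
                 (*-congʳ (+-rotate (sq x₃) (sq x₁) (sq x₂)))

    row₃ : a₃ * a₃ + sq x₃ * a₃ + sq d₃ * a₃ ≈ S * a₃
    row₃ = row-identity (sq x₁ + sq x₂) (sq x₃) (sq d₃)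

    cuboid-identity :
      (a₁ * a₁ + a₂ * a₂ + a₃ * a₃)
        + q₆ x₁ x₂ x₃ d₁ d₂ d₃ + q₇ x₁ x₂ x₃ d₁ d₂ d₃
      ≈ S * q₂ x₁ x₂ x₃ d₁ d₂ d₃
    cuboid-identity = begin
      (a₁ * a₁ + a₂ * a₂ + a₃ * a₃) + q₆ x₁ x₂ x₃ d₁ d₂ d₃ + q₇ x₁ x₂ x₃ d₁ d₂ d₃
        ≈⟨ +-congʳ (+-triple-interchange _ _ _ _ _ _) ⟩
      (a₁ * a₁ + sq x₁ * a₁) + (a₂ * a₂ + sq x₂ * a₂) + (a₃ * a₃ + sq x₃ * a₃)
        + q₇ x₁ x₂ x₃ d₁ d₂ d₃
        ≈⟨ +-triple-interchange _ _ _ _ _ _ ⟩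
      (a₁ * a₁ + sq x₁ * a₁ + sq d₁ * a₁) + (a₂ * a₂ + sq x₂ * a₂ + sq d₂ * a₂)
        + (a₃ * a₃ + sq x₃ * a₃ + sq d₃ * a₃)
        ≈⟨ +-cong (+-cong row₁ row₂) row₃ ⟩
      S * a₁ + S * a₂ + S * a₃
        ≈⟨ +-congʳ (distribˡ S a₁ a₂) ⟨
      S * (a₁ + a₂) + S * a₃
        ≈⟨ distribˡ S (a₁ + a₂) a₃ ⟨
      S * q₂ x₁ x₂ x₃ d₁ d₂ d₃
        ∎

    squares-vanish :
      q₂ x₁ x₂ x₃ d₁ d₂ d₃ ≈ 0# → q₆ x₁ x₂ x₃ d₁ d₂ d₃ ≈ 0# → q₇ x₁ x₂ x₃ d₁ d₂ d₃ ≈ 0# →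
      a₁ * a₁ + a₂ * a₂ + a₃ * a₃ ≈ 0#
    squares-vanish q₂≈0 q₆≈0 q₇≈0 = begin
      A                  ≈⟨ +-identityʳ A ⟨
      A + 0#             ≈⟨ +-identityʳ (A + 0#) ⟨
      A + 0# + 0#        ≈⟨ +-cong (+-congˡ q₆≈0) q₇≈0 ⟨
      A + q₆ x₁ x₂ x₃ d₁ d₂ d₃ + q₇ x₁ x₂ x₃ d₁ d₂ d₃
                         ≈⟨ cuboid-identity ⟩
      S * q₂ x₁ x₂ x₃ d₁ d₂ d₃
                         ≈⟨ *-congˡ q₂≈0 ⟩
      S * 0#             ≈⟨ zeroʳ S ⟩
      0#                 ∎
      where
      A : Carrier
      A = a₁ * a₁ + a₂ * a₂ + a₃ * a₃

module ThreeSquares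
  {A : Set} (_+_ _*_ : A → A → A) (0# : A) (Positive NonNegative : A → Set)
  (zero-not-positive : ¬ Positive 0#)
  (pos+nonneg : ∀ {u v} → Positive u → NonNegative v → Positive (u + v))
  (nonneg+pos : ∀ {u v} → NonNegative u → Positive v → Positive (u + v))
  (nonneg+nonneg : ∀ {u v} → NonNegative u → NonNegative v → NonNegative (u + v))
  (square-nonneg : ∀ x → NonNegative (x * x))
  (square-zero-or-pos : ∀ x → x ≡ 0# ⊎ Positive (x * x))
  where
  open import Relation.Binary.PropositionalEquality using (subst)

  zero-if-square-forces : ∀ {s} x → s ≡ 0# → (Positive (x * x) → Positive s) → x ≡ 0#
  zero-if-square-forces x s≡0 forces with square-zero-or-pos x
  ... | inj₁ x≡0 = x≡0
  ... | inj₂ x²>0 = ⊥-elim (zero-not-positive (subst Positive s≡0 (forces x²>0)))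

  -- Each term is forced to vanish, since its positive square would make the
  -- whole (vanishing) sum positive.
  three-squares-vanish : ∀ a b c → ((a * a) + (b * b)) + (c * c) ≡ 0# →
                         a ≡ 0# × b ≡ 0# × c ≡ 0#
  three-squares-vanish a b c sum≡0 =
      zero-if-square-forces a sum≡0 (λ a²>0 → pos+nonneg (pos+nonneg a²>0 b²≥0) c²≥0)
    , zero-if-square-forces b sum≡0 (λ b²>0 → pos+nonneg (nonneg+pos a²≥0 b²>0) c²≥0)
    , zero-if-square-forces c sum≡0 (λ c²>0 → nonneg+pos (nonneg+nonneg a²≥0 b²≥0) c²>0)
    where
    a²≥0 : NonNegative (a * a)
    a²≥0 = square-nonneg a
    b²≥0 : NonNegative (b * b)
    b²≥0 = square-nonneg b
    c²≥0 : NonNegative (c * c)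
    c²≥0 = square-nonneg c

module IntegerSquares where
  open import Data.Integer using (0ℤ; _<_; _≤_; _*_; positive; negative)
  open import Relation.Binary.PropositionalEquality using (refl; subst)

  square-zero-or-pos : ∀ x → x ≡ 0ℤ ⊎ 0ℤ < x * x
  square-zero-or-pos x with ℤₚ.<-cmp x 0ℤ
  ... | tri< x<0 _ _ = inj₂ (subst (_< x * x) (ℤₚ.*-zeroʳ x) (ℤₚ.*-monoˡ-<-neg x {{negative x<0}} x<0))
  ... | tri≈ _ x≡0 _ = inj₁ x≡0
  ... | tri> _ _ x>0 = inj₂ (subst (_< x * x) (ℤₚ.*-zeroʳ x) (ℤₚ.*-monoˡ-<-pos x {{positive x>0}} x>0))

  square-nonneg : ∀ x → 0ℤ ≤ x * x
  square-nonneg x with square-zero-or-pos x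
  ... | inj₁ refl = ℤₚ.≤-refl
  ... | inj₂ x²>0 = ℤₚ.<⇒≤ x²>0

  open ThreeSquares ℤ._+_ _*_ 0ℤ (0ℤ <_) (0ℤ ≤_) (ℤₚ.<-irrefl refl)
    ℤₚ.+-mono-<-≤ ℤₚ.+-mono-≤-< ℤₚ.+-mono-≤ square-nonneg square-zero-or-pos
    public

module RationalSquares where
  open import Data.Rational using (0ℚ; _<_; _≤_; _*_; positive; negative)
  open import Relation.Binary.PropositionalEquality using (refl; subst)

  square-zero-or-pos : ∀ x → x ≡ 0ℚ ⊎ 0ℚ < x * x
  square-zero-or-pos x with ℚₚ.<-cmp x 0ℚ
  ... | tri< x<0 _ _ = inj₂ (subst (_< x * x) (ℚₚ.*-zeroˡ x) (ℚₚ.*-monoˡ-<-neg x {{negative x<0}} x<0))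
  ... | tri≈ _ x≡0 _ = inj₁ x≡0
  ... | tri> _ _ x>0 = inj₂ (subst (_< x * x) (ℚₚ.*-zeroˡ x) (ℚₚ.*-monoˡ-<-pos x {{positive x>0}} x>0))

  square-nonneg : ∀ x → 0ℚ ≤ x * x
  square-nonneg x with square-zero-or-pos x
  ... | inj₁ refl = ℚₚ.≤-refl
  ... | inj₂ x²>0 = ℚₚ.<⇒≤ x²>0

  open ThreeSquares ℚ._+_ _*_ 0ℚ (0ℚ <_) (0ℚ ≤_) (ℚₚ.<-irrefl refl)
    ℚₚ.+-mono-<-≤ ℚₚ.+-mono-≤-< ℚₚ.+-mono-≤ square-nonneg square-zero-or-pos
    public

cuboid-equations-ℤ : ∀ x₁ x₂ x₃ d₁ d₂ d₃ →
  ℤP.q₂ x₁ x₂ x₃ d₁ d₂ d₃ ≡ ℤ.0ℤ →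
  ℤP.q₆ x₁ x₂ x₃ d₁ d₂ d₃ ≡ ℤ.0ℤ →
  ℤP.q₇ x₁ x₂ x₃ d₁ d₂ d₃ ≡ ℤ.0ℤ →
  (ℤP.p₁ x₁ x₂ x₃ d₁ ≡ ℤ.0ℤ) × (ℤP.p₂ x₁ x₂ x₃ d₂ ≡ ℤ.0ℤ) × (ℤP.p₃ x₁ x₂ x₃ d₃ ≡ ℤ.0ℤ)
cuboid-equations-ℤ x₁ x₂ x₃ d₁ d₂ d₃ q₂≡0 q₆≡0 q₇≡0 =
  IntegerSquares.three-squares-vanish _ _ _
    (CuboidIdentity.squares-vanish ℤₚ.+-*-commutativeRing x₁ x₂ x₃ d₁ d₂ d₃ q₂≡0 q₆≡0 q₇≡0)

cuboid-equations-ℚ : ∀ x₁ x₂ x₃ d₁ d₂ d₃ →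
  ℚP.q₂ x₁ x₂ x₃ d₁ d₂ d₃ ≡ ℚ.0ℚ →
  ℚP.q₆ x₁ x₂ x₃ d₁ d₂ d₃ ≡ ℚ.0ℚ →
  ℚP.q₇ x₁ x₂ x₃ d₁ d₂ d₃ ≡ ℚ.0ℚ →
  (ℚP.p₁ x₁ x₂ x₃ d₁ ≡ ℚ.0ℚ) × (ℚP.p₂ x₁ x₂ x₃ d₂ ≡ ℚ.0ℚ) × (ℚP.p₃ x₁ x₂ x₃ d₃ ≡ ℚ.0ℚ)
cuboid-equations-ℚ x₁ x₂ x₃ d₁ d₂ d₃ q₂≡0 q₆≡0 q₇≡0 =
  RationalSquares.three-squares-vanish _ _ _
    (CuboidIdentity.squares-vanish ℚₚ.+-*-commutativeRing x₁ x₂ x₃ d₁ d₂ d₃ q₂≡0 q₆≡0 q₇≡0)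

-- Theorem 1.3: only p̃₂, p̃₆ and p̃₇ are used.
theorem1p3 :
    ((x₁ x₂ x₃ d₁ d₂ d₃ L : ℤ) →
      ℤ.0ℤ ℤ.< x₁ → ℤ.0ℤ ℤ.< x₂ → ℤ.0ℤ ℤ.< x₃ →
      ℤ.0ℤ ℤ.< d₁ → ℤ.0ℤ ℤ.< d₂ → ℤ.0ℤ ℤ.< d₃ →
      ℤP.q₂ x₁ x₂ x₃ d₁ d₂ d₃ ≡ ℤ.0ℤ →
      ℤP.q₃ x₁ x₂ x₃ d₁ d₂ d₃ ≡ ℤ.0ℤ →
      ℤP.q₄ x₁ x₂ x₃ d₁ d₂ d₃ ≡ ℤ.0ℤ →
      ℤP.q₅ x₁ x₂ x₃ d₁ d₂ d₃ ≡ ℤ.0ℤ →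
      ℤP.q₆ x₁ x₂ x₃ d₁ d₂ d₃ ≡ ℤ.0ℤ →
      ℤP.q₇ x₁ x₂ x₃ d₁ d₂ d₃ ≡ ℤ.0ℤ →
      ℤP.q₈ x₁ x₂ x₃ d₁ d₂ d₃ ≡ ℤ.0ℤ →
      (ℤP.p₁ x₁ x₂ x₃ d₁ ≡ ℤ.0ℤ) × (ℤP.p₂ x₁ x₂ x₃ d₂ ≡ ℤ.0ℤ) × (ℤP.p₃ x₁ x₂ x₃ d₃ ≡ ℤ.0ℤ))
    ×
    ((x₁ x₂ x₃ d₁ d₂ d₃ L : ℚ) →
      ℚ.0ℚ ℚ.< x₁ → ℚ.0ℚ ℚ.< x₂ → ℚ.0ℚ ℚ.< x₃ →
      ℚ.0ℚ ℚ.< d₁ → ℚ.0ℚ ℚ.< d₂ → ℚ.0ℚ ℚ.< d₃ →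
      ℚP.q₂ x₁ x₂ x₃ d₁ d₂ d₃ ≡ ℚ.0ℚ →
      ℚP.q₃ x₁ x₂ x₃ d₁ d₂ d₃ ≡ ℚ.0ℚ →
      ℚP.q₄ x₁ x₂ x₃ d₁ d₂ d₃ ≡ ℚ.0ℚ →
      ℚP.q₅ x₁ x₂ x₃ d₁ d₂ d₃ ≡ ℚ.0ℚ →
      ℚP.q₆ x₁ x₂ x₃ d₁ d₂ d₃ ≡ ℚ.0ℚ →
      ℚP.q₇ x₁ x₂ x₃ d₁ d₂ d₃ ≡ ℚ.0ℚ →
      ℚP.q₈ x₁ x₂ x₃ d₁ d₂ d₃ ≡ ℚ.0ℚ →
      (ℚP.p₁ x₁ x₂ x₃ d₁ ≡ ℚ.0ℚ) × (ℚP.p₂ x₁ x₂ x₃ d₂ ≡ ℚ.0ℚ) × (ℚP.p₃ x₁ x₂ x₃ d₃ ≡ ℚ.0ℚ))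
theorem1p3 =
    (λ x₁ x₂ x₃ d₁ d₂ d₃ _ _ _ _ _ _ _ q₂≡0 _ _ _ q₆≡0 q₇≡0 _ →
       cuboid-equations-ℤ x₁ x₂ x₃ d₁ d₂ d₃ q₂≡0 q₆≡0 q₇≡0)
  , (λ x₁ x₂ x₃ d₁ d₂ d₃ _ _ _ _ _ _ _ q₂≡0 _ _ _ q₆≡0 q₇≡0 _ →
       cuboid-equations-ℚ x₁ x₂ x₃ d₁ d₂ d₃ q₂≡0 q₆≡0 q₇≡0)
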